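{- Let $\mathcal{S}_G=\{(-1,0),(1,0),(-1,-1),(1,1)\}\subset\mathbb{Z}^2$ (the Gessel step set), and for $t\ge0$ and $\mathbf{b}\in\mathbb{Z}^2$ let $F_t^G(\mathbf{b})$ be the number of sequences $s_1\cdots s_t$ with $s_i\in\mathcal{S}_G$ and $s_1+\cdots+s_t=\mathbf{b}$ (free Gessel paths of length $t$ from $(0,0)$ to $\mathbf{b}$, no boundary constraint). Let the isometry group of the free Gessel paths be the set of matrices $g\in GL_2(\mathbb{Z})$, acting on row vectors by $\mathbf{b}\mapsto\mathbf{b}g$, such that $F_t^G(\mathbf{b}g)=F_t^G(\mathbf{b})$ for all $t\ge0$ and all $\mathbf{b}\in\mathbb{Z}^2$. Then this group is a dihedral group $D_4$ of order eight, consisting of the identity matrix together with the four reflections $$g_1=\begin{pmatrix}1&0\\-2&-1\end{pmatrix},\ g_2=\begin{pmatrix}-1&-1\\0&1\end{pmatrix},\ g_3=\begin{pmatrix}1&1\\0&-1\end{pmatrix},\ g_4=\begin{pmatrix}-1&0\\2&1\end{pmatrix},$$ whose lines of fixed points are $y=0$, $x=0$, $y=x/2$ and $y=x$ respectively, and the three rotations $$g_5=g_1g_4=\begin{pmatrix}-1&0\\0&-1\end{pmatrix},\ g_6=g_1g_3=\begin{pmatrix}1&1\\-2&-1\end{pmatrix},\ g_7=g_1g_2=\begin{pmatrix}-1&-1\\2&1\end{pmatrix}.$$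
   Context: Matrices act on the right of row vectors $(x,y)$; the line of fixed points of $g$ is $\{(x,y):(x,y)g=(x,y)\}$. -}

module Defs where

open import Data.Nat using (ℕ; zero; suc)
open import Data.Integer using (ℤ; +_; -[1+_]; _+_; _*_; _-_; -_)
import Data.Integer as ℤ
open import Data.Product using (_×_; _,_)
open import Data.Product.Properties using (≡-dec)
open import Data.List using (List; []; _∷_; length; filter; map; concatMap; foldr)
open import Relation.Binary.PropositionalEquality using (_≡_)
open import Relation.Nullary using (Dec)
open import Data.Sum using (_⊎_)

Pt : Set
Pt = ℤ × ℤ

_≟ᵖ_ : (p q : Pt) → Dec (p ≡ q)
_≟ᵖ_ = ≡-dec ℤ._≟_ ℤ._≟_

_⊕_ : Pt → Pt → Pt
(a , b) ⊕ (c , d) = (a + c , b + d)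

gesselSteps : List Pt
gesselSteps = (- + 1 , + 0) ∷ (+ 1 , + 0) ∷ (- + 1 , - + 1) ∷ (+ 1 , + 1) ∷ []

words : ℕ → List (List Pt)
words zero    = [] ∷ []
words (suc t) = concatMap (λ s → map (s ∷_) (words t)) gesselSteps

endpoint : List Pt → Pt
endpoint = foldr _⊕_ (+ 0 , + 0)

F : ℕ → Pt → ℕ
F t b = length (filter (λ w → endpoint w ≟ᵖ b) (words t))

-- 2×2 integer matrix  ((a , b) , (c , d))  =  [[a, b], [c, d]]
Mat : Set
Mat = (ℤ × ℤ) × (ℤ × ℤ)

mat : ℤ → ℤ → ℤ → ℤ → Mat
mat a b c d = ((a , b) , (c , d))

det : Mat → ℤ
det ((a , b) , (c , d)) = a * d - b * c

IsGL2 : Mat → Set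
IsGL2 g = (det g ≡ + 1) ⊎ (det g ≡ - + 1)

_·ᵥ_ : Pt → Mat → Pt
(x , y) ·ᵥ ((a , b) , (c , d)) = (x * a + y * c , x * b + y * d)

_·_ : Mat → Mat → Mat
((a , b) , (c , d)) · ((a' , b') , (c' , d')) =
  ((a * a' + b * c' , a * b' + b * d') , (c * a' + d * c' , c * b' + d * d'))

IsIsometry : Mat → Set
IsIsometry g = ∀ (t : ℕ) (b : Pt) → F t (b ·ᵥ g) ≡ F t b

Fixed : Mat → Pt → Set
Fixed g p = p ·ᵥ g ≡ p

idM g₁ g₂ g₃ g₄ g₅ g₆ g₇ : Mat
idM = mat (+ 1) (+ 0) (+ 0) (+ 1)
g₁ = mat (+ 1) (+ 0) (- + 2) (- + 1)
g₂ = mat (- + 1) (- + 1) (+ 0) (+ 1)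
g₃ = mat (+ 1) (+ 1) (+ 0) (- + 1)
g₄ = mat (- + 1) (+ 0) (+ 2) (+ 1)
g₅ = mat (- + 1) (+ 0) (+ 0) (- + 1)
g₆ = mat (+ 1) (+ 1) (- + 2) (- + 1)
g₇ = mat (- + 1) (- + 1) (+ 2) (+ 1)

D₄ : List Mat
D₄ = idM ∷ g₁ ∷ g₂ ∷ g₃ ∷ g₄ ∷ g₅ ∷ g₆ ∷ g₇ ∷ []

-- F (t+1) b = Σ_{s ∈ S} F t (b − s), so an invertible matrix that permutes the step set S
-- preserves every F t; g₁ and g₂ do so, and they generate D₄.  Conversely F 1 is the
-- indicator function of S, so an isometry g maps (1,0) and (1,1) into S.  These two images
-- determine g, and of the sixteen resulting candidates the eight nonsingular ones are D₄.
module Submission where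

open import Defs
open import Data.Integer using (ℤ; +_; _*_)
open import Data.Product using (_×_; _,_)
open import Data.List.Membership.Propositional using (_∈_)
open import Data.List.Relation.Unary.Unique.Propositional using (Unique)
open import Function.Bundles using (_⇔_)
open import Relation.Binary.PropositionalEquality using (_≡_)

open import Data.Nat using (ℕ; zero; suc)
import Data.Nat as ℕ
open import Data.Nat.ListAction using (sum)
open import Data.Nat.ListAction.Properties using (sum-↭)
open import Data.Integer using (-_; _-_; -[1+_])
import Data.Integer as ℤ
import Data.Integer.Properties as ℤ
open import Data.Integer.Tactic.RingSolver using (solve-∀)
open import Data.Product using (proj₁; proj₂)
open import Data.Product.Properties using (≡-dec)
open import Data.List using (List; []; _∷_; _++_; length; filter; map; concatMap)
open import Data.List.Properties using (length-++; filter-++; filter-none; map-∘; map-cong)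
open import Data.List.Relation.Unary.Any using (Any; here; there; any?)
import Data.List.Relation.Unary.Any as Any
open import Data.List.Relation.Unary.Any.Properties using (map⁺)
open import Data.List.Relation.Unary.All using (All; []; _∷_; all?)
import Data.List.Relation.Unary.All as All
open import Data.List.Relation.Unary.All.Properties.Core using (¬Any⇒All¬)
open import Data.List.Relation.Binary.Permutation.Propositional using (_↭_; prep; swap; refl)
import Data.List.Relation.Binary.Permutation.Propositional.Properties as ↭
open import Data.List.Membership.DecPropositional (≡-dec _≟ᵖ_ _≟ᵖ_) using (_∈?_)
open import Data.List.Relation.Unary.Unique.DecPropositional (≡-dec _≟ᵖ_ _≟ᵖ_) using (unique?)
open import Function.Base using (_∘_)
open import Function.Bundles using (mk⇔)
open import Relation.Nullary using (Dec; yes; no; contradiction)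
open import Relation.Nullary.Decidable using (from-yes; decidable-stable; _⊎-dec_; _→-dec_)
open import Relation.Binary.PropositionalEquality
  using (_≢_; refl; sym; trans; cong; cong₂; subst; module ≡-Reasoning)

origin : Pt
origin = (+ 0 , + 0)

_⊖_ : Pt → Pt → Pt
(a , b) ⊖ (c , d) = (a - c , b - d)

⊕≡⇒≡⊖ : ∀ s e b → s ⊕ e ≡ b → e ≡ b ⊖ s
⊕≡⇒≡⊖ (s₁ , s₂) (e₁ , e₂) _ refl = cong₂ _,_ (cancel s₁ e₁) (cancel s₂ e₂)
  where
  cancel : ∀ s e → e ≡ (s ℤ.+ e) - s
  cancel = solve-∀

≡⊖⇒⊕≡ : ∀ s e b → e ≡ b ⊖ s → s ⊕ e ≡ b
≡⊖⇒⊕≡ (s₁ , s₂) _ (b₁ , b₂) refl = cong₂ _,_ (cancel s₁ b₁) (cancel s₂ b₂)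
  where
  cancel : ∀ s b → s ℤ.+ (b - s) ≡ b
  cancel = solve-∀

·ᵥ-distrib-⊖ : ∀ p q g → (p ⊖ q) ·ᵥ g ≡ (p ·ᵥ g) ⊖ (q ·ᵥ g)
·ᵥ-distrib-⊖ (x , y) (u , v) ((a , b) , (c , d)) =
  cong₂ _,_ (distrib x y u v a c) (distrib x y u v b d)
  where
  distrib : ∀ x y u v a c →
            (x - u) * a ℤ.+ (y - v) * c ≡ (x * a ℤ.+ y * c) - (u * a ℤ.+ v * c)
  distrib = solve-∀

·ᵥ-assoc : ∀ p g h → (p ·ᵥ g) ·ᵥ h ≡ p ·ᵥ (g · h)
·ᵥ-assoc (x , y) ((a , b) , (c , d)) ((a' , b') , (c' , d')) =
  cong₂ _,_ (assoc x y a b c d a' c') (assoc x y a b c d b' d')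
  where
  assoc : ∀ x y a b c d a' c' →
          (x * a ℤ.+ y * c) * a' ℤ.+ (x * b ℤ.+ y * d) * c'
            ≡ x * (a * a' ℤ.+ b * c') ℤ.+ y * (c * a' ℤ.+ d * c')
  assoc = solve-∀

·ᵥ-identityʳ : ∀ p → p ·ᵥ idM ≡ p
·ᵥ-identityʳ (x , y) = cong₂ _,_ (first x y) (second x y)
  where
  first : ∀ x y → x * + 1 ℤ.+ y * + 0 ≡ x
  first = solve-∀
  second : ∀ x y → x * + 0 ℤ.+ y * + 1 ≡ y
  second = solve-∀

origin-·ᵥ : ∀ g → origin ·ᵥ g ≡ origin
origin-·ᵥ ((a , b) , (c , d)) = cong₂ _,_ (vanish a c) (vanish b d)
  where
  vanish : ∀ a c → + 0 * a ℤ.+ + 0 * c ≡ + 0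
  vanish = solve-∀

·ᵥ-reflects-origin : ∀ {g h} → g · h ≡ idM → ∀ p → p ·ᵥ g ≡ origin → p ≡ origin
·ᵥ-reflects-origin {g} {h} gh≡id p pg≡0 = begin
  p                ≡⟨ sym (·ᵥ-identityʳ p) ⟩
  p ·ᵥ idM         ≡⟨ cong (p ·ᵥ_) (sym gh≡id) ⟩
  p ·ᵥ (g · h)     ≡⟨ sym (·ᵥ-assoc p g h) ⟩
  (p ·ᵥ g) ·ᵥ h    ≡⟨ cong (_·ᵥ h) pg≡0 ⟩
  origin ·ᵥ h      ≡⟨ origin-·ᵥ h ⟩
  origin           ∎
  where open ≡-Reasoning

count : Pt → List (List Pt) → ℕ
count b = length ∘ filter (λ w → endpoint w ≟ᵖ b)

count-++ : ∀ b xs ys → count b (xs ++ ys) ≡ count b xs ℕ.+ count b ys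
count-++ b xs ys =
  trans (cong length (filter-++ reaches? xs ys)) (length-++ (filter reaches? xs))
  where
  reaches? : (w : List Pt) → Dec (endpoint w ≡ b)
  reaches? w = endpoint w ≟ᵖ b

count-prepend : ∀ b s W → count b (map (s ∷_) W) ≡ count (b ⊖ s) W
count-prepend b s [] = refl
count-prepend b s (w ∷ W) with (s ⊕ endpoint w) ≟ᵖ b | endpoint w ≟ᵖ (b ⊖ s)
... | yes _ | yes _ = cong suc (count-prepend b s W)
... | no  _ | no  _ = count-prepend b s W
... | yes e | no ¬e = contradiction (⊕≡⇒≡⊖ s (endpoint w) b e) ¬e
... | no ¬e | yes e = contradiction (≡⊖⇒⊕≡ s (endpoint w) b e) ¬e

count-extend : ∀ b S W →
  count b (concatMap (λ s → map (s ∷_) W) S) ≡ sum (map (λ s → count (b ⊖ s) W) S)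
count-extend b []      W = refl
count-extend b (s ∷ S) W = begin
  count b (map (s ∷_) W ++ concatMap (λ s → map (s ∷_) W) S)
    ≡⟨ count-++ b (map (s ∷_) W) _ ⟩
  count b (map (s ∷_) W) ℕ.+ count b (concatMap (λ s → map (s ∷_) W) S)
    ≡⟨ cong₂ ℕ._+_ (count-prepend b s W) (count-extend b S W) ⟩
  count (b ⊖ s) W ℕ.+ sum (map (λ s → count (b ⊖ s) W) S)
    ∎
  where open ≡-Reasoning

count≢0⇒Any : ∀ b W → count b W ≢ 0 → Any (λ w → endpoint w ≡ b) W
count≢0⇒Any b W count≢0 = decidable-stable (any? (λ w → endpoint w ≟ᵖ b) W)
  λ ¬any → count≢0 (cong length (filter-none _ (¬Any⇒All¬ W ¬any)))

F-suc : ∀ t b → F (suc t) b ≡ sum (map (λ s → F t (b ⊖ s)) gesselSteps)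
F-suc t b = count-extend b gesselSteps (words t)

F-zero-cong : ∀ {p q} → (p ≡ origin → q ≡ origin) → (q ≡ origin → p ≡ origin) →
              F 0 p ≡ F 0 q
F-zero-cong {p} {q} p⇒q q⇒p with origin ≟ᵖ p | origin ≟ᵖ q
... | yes _  | yes _  = refl
... | no  _  | no  _  = refl
... | yes p₀ | no ¬q₀ = contradiction (sym (p⇒q (sym p₀))) ¬q₀
... | no ¬p₀ | yes q₀ = contradiction (sym (q⇒p (sym q₀))) ¬p₀

-- map endpoint (words 1) reduces to gesselSteps.
F-one≢0⇒∈steps : ∀ b → F 1 b ≢ 0 → b ∈ gesselSteps
F-one≢0⇒∈steps b F≢0 = Any.map sym (map⁺ (count≢0⇒Any b (words 1) F≢0))

PermutesSteps : Mat → Set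
PermutesSteps g = map (_·ᵥ g) gesselSteps ↭ gesselSteps

permutesSteps⇒isometry : ∀ {g h} → g · h ≡ idM → PermutesSteps g → IsIsometry g
permutesSteps⇒isometry {g} {h} gh≡id perm = invariant
  where
  invariant : ∀ t b → F t (b ·ᵥ g) ≡ F t b
  invariant zero    b = F-zero-cong (·ᵥ-reflects-origin gh≡id b)
                                    (λ b≡0 → trans (cong (_·ᵥ g) b≡0) (origin-·ᵥ g))
  invariant (suc t) b = begin
    F (suc t) (b ·ᵥ g)                                   ≡⟨ F-suc t (b ·ᵥ g) ⟩
    sum (map next gesselSteps)                           ≡⟨ sum-↭ (↭.map⁺ next perm) ⟨
    sum (map next (map (_·ᵥ g) gesselSteps))             ≡⟨ cong sum (map-∘ {g = next} {f = _·ᵥ g} gesselSteps) ⟨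
    sum (map (next ∘ (_·ᵥ g)) gesselSteps)               ≡⟨ cong sum (map-cong back gesselSteps) ⟩
    sum (map (λ s → F t (b ⊖ s)) gesselSteps)            ≡⟨ F-suc t b ⟨
    F (suc t) b                                          ∎
    where
    open ≡-Reasoning
    next : Pt → ℕ
    next s = F t ((b ·ᵥ g) ⊖ s)
    back : ∀ s → next (s ·ᵥ g) ≡ F t (b ⊖ s)
    back s = trans (cong (F t) (sym (·ᵥ-distrib-⊖ b s g))) (invariant t (b ⊖ s))

isometry-· : ∀ {g h} → IsIsometry g → IsIsometry h → IsIsometry (g · h)
isometry-· {g} {h} iso-g iso-h t b = begin
  F t (b ·ᵥ (g · h))   ≡⟨ cong (F t) (·ᵥ-assoc b g h) ⟨
  F t ((b ·ᵥ g) ·ᵥ h)  ≡⟨ iso-h t (b ·ᵥ g) ⟩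
  F t (b ·ᵥ g)         ≡⟨ iso-g t b ⟩
  F t b                ∎
  where open ≡-Reasoning

isometry-g₁ : IsIsometry g₁
isometry-g₁ = permutesSteps⇒isometry {h = g₁} refl (prep _ (prep _ (swap _ _ refl)))

isometry-g₂ : IsIsometry g₂
isometry-g₂ = permutesSteps⇒isometry {h = g₂} refl (↭.↭-reverse gesselSteps)

D₄-isometries : All IsIsometry D₄
D₄-isometries = isometry-· isometry-g₁ isometry-g₁
              ∷ isometry-g₁
              ∷ isometry-g₂
              ∷ isometry-· isometry-g₁ (isometry-· isometry-g₂ isometry-g₁)
              ∷ isometry-· isometry-g₁ (isometry-· quarterTurn quarterTurn)
              ∷ isometry-· quarterTurn quarterTurn
              ∷ isometry-· isometry-g₂ isometry-g₁
              ∷ quarterTurn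
              ∷ []
  where
  quarterTurn : IsIsometry (g₁ · g₂)
  quarterTurn = isometry-· isometry-g₁ isometry-g₂

isGL2? : ∀ g → Dec (IsGL2 g)
isGL2? g = (det g ℤ.≟ + 1) ⊎-dec (det g ℤ.≟ - + 1)

D₄-invertible : All IsGL2 D₄
D₄-invertible = from-yes (all? isGL2? D₄)

steps-reachable : ∀ {s} → s ∈ gesselSteps → F 1 s ≢ 0
steps-reachable (here refl)                         = λ ()
steps-reachable (there (here refl))                 = λ ()
steps-reachable (there (there (here refl)))         = λ ()
steps-reachable (there (there (there (here refl)))) = λ ()

isometry-preserves-steps :
  ∀ {g} → IsIsometry g → ∀ {s} → s ∈ gesselSteps → s ·ᵥ g ∈ gesselSteps
isometry-preserves-steps {g} iso {s} s∈ =
  F-one≢0⇒∈steps (s ·ᵥ g) (λ F≡0 → steps-reachable s∈ (trans (sym (iso 1 s)) F≡0))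

fromImages : Pt → Pt → Mat
fromImages p q = (p , q ⊖ p)

fromImages-images : ∀ g → fromImages ((+ 1 , + 0) ·ᵥ g) ((+ 1 , + 1) ·ᵥ g) ≡ g
fromImages-images ((a , b) , (c , d)) =
  cong₂ _,_ (cong₂ _,_ (first a c) (first b d)) (cong₂ _,_ (second a c) (second b d))
  where
  first : ∀ a c → + 1 * a ℤ.+ + 0 * c ≡ a
  first = solve-∀
  second : ∀ a c → (+ 1 * a ℤ.+ + 1 * c) - (+ 1 * a ℤ.+ + 0 * c) ≡ c
  second = solve-∀

-- det (fromImages p q) = p₁ q₂ - p₂ q₁: the eight pairs of collinear steps give singular
-- matrices, and the other eight pairs give exactly the elements of D₄.
fromImages-classification :
  All (λ p → All (λ q → IsGL2 (fromImages p q) → fromImages p q ∈ D₄) gesselSteps) gesselSteps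
fromImages-classification =
  from-yes (all? (λ p → all? (λ q → candidate? (fromImages p q)) gesselSteps) gesselSteps)
  where
  candidate? : ∀ g → Dec (IsGL2 g → g ∈ D₄)
  candidate? g = isGL2? g →-dec (g ∈? D₄)

isometry⇒∈D₄ : ∀ g → IsGL2 g → IsIsometry g → g ∈ D₄
isometry⇒∈D₄ g gl iso = subst (_∈ D₄) (fromImages-images g)
  (All.lookup (All.lookup fromImages-classification image₁) image₂
    (subst IsGL2 (sym (fromImages-images g)) gl))
  where
  image₁ : (+ 1 , + 0) ·ᵥ g ∈ gesselSteps
  image₁ = isometry-preserves-steps iso (there (here refl))
  image₂ : (+ 1 , + 1) ·ᵥ g ∈ gesselSteps
  image₂ = isometry-preserves-steps iso (there (there (there (here refl))))

-x≡x⇒x≡0 : ∀ x → - x ≡ x → x ≡ + 0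
-x≡x⇒x≡0 (+ zero) _  = refl
-x≡x⇒x≡0 (+ suc n) ()
-x≡x⇒x≡0 -[1+ n ] ()

x-y≡y⇒x≡2y : ∀ x y → x - y ≡ y → x ≡ + 2 * y
x-y≡y⇒x≡2y x y x-y≡y = begin
  x                ≡⟨ split x y ⟩
  (x - y) ℤ.+ y    ≡⟨ cong (ℤ._+ y) x-y≡y ⟩
  y ℤ.+ y          ≡⟨ double y ⟩
  + 2 * y          ∎
  where
  open ≡-Reasoning
  split : ∀ x y → x ≡ (x - y) ℤ.+ y
  split = solve-∀
  double : ∀ y → y ℤ.+ y ≡ + 2 * y
  double = solve-∀

action-g₁ : ∀ x y → (x , y) ·ᵥ g₁ ≡ (x - + 2 * y , - y)
action-g₁ x y = cong₂ _,_ (first x y) (second x y)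
  where
  first : ∀ x y → x * + 1 ℤ.+ y * - + 2 ≡ x - + 2 * y
  first = solve-∀
  second : ∀ x y → x * + 0 ℤ.+ y * - + 1 ≡ - y
  second = solve-∀

action-g₂ : ∀ x y → (x , y) ·ᵥ g₂ ≡ (- x , y - x)
action-g₂ x y = cong₂ _,_ (first x y) (second x y)
  where
  first : ∀ x y → x * - + 1 ℤ.+ y * + 0 ≡ - x
  first = solve-∀
  second : ∀ x y → x * - + 1 ℤ.+ y * + 1 ≡ y - x
  second = solve-∀

action-g₃ : ∀ x y → (x , y) ·ᵥ g₃ ≡ (x , x - y)
action-g₃ x y = cong₂ _,_ (first x y) (second x y)
  where
  first : ∀ x y → x * + 1 ℤ.+ y * + 0 ≡ x
  first = solve-∀
  second : ∀ x y → x * + 1 ℤ.+ y * - + 1 ≡ x - y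
  second = solve-∀

action-g₄ : ∀ x y → (x , y) ·ᵥ g₄ ≡ (+ 2 * y - x , y)
action-g₄ x y = cong₂ _,_ (first x y) (second x y)
  where
  first : ∀ x y → x * - + 1 ℤ.+ y * + 2 ≡ + 2 * y - x
  first = solve-∀
  second : ∀ x y → x * + 0 ℤ.+ y * + 1 ≡ y
  second = solve-∀

fixed-g₁ : (x y : ℤ) → Fixed g₁ (x , y) ⇔ (y ≡ + 0)
fixed-g₁ x y = mk⇔
  (λ fix → -x≡x⇒x≡0 y (cong proj₂ (trans (sym (action-g₁ x y)) fix)))
  (λ { refl → trans (action-g₁ x (+ 0)) (cong (_, + 0) (ℤ.+-identityʳ x)) })

fixed-g₂ : (x y : ℤ) → Fixed g₂ (x , y) ⇔ (x ≡ + 0)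
fixed-g₂ x y = mk⇔
  (λ fix → -x≡x⇒x≡0 x (cong proj₁ (trans (sym (action-g₂ x y)) fix)))
  (λ { refl → trans (action-g₂ (+ 0) y) (cong (+ 0 ,_) (ℤ.+-identityʳ y)) })

fixed-g₃ : (x y : ℤ) → Fixed g₃ (x , y) ⇔ (x ≡ + 2 * y)
fixed-g₃ x y = mk⇔
  (λ fix → x-y≡y⇒x≡2y x y (cong proj₂ (trans (sym (action-g₃ x y)) fix)))
  (λ { refl → trans (action-g₃ (+ 2 * y) y) (cong (+ 2 * y ,_) (2y-y≡y y)) })
  where
  2y-y≡y : ∀ y → + 2 * y - y ≡ y
  2y-y≡y = solve-∀

fixed-g₄ : (x y : ℤ) → Fixed g₄ (x , y) ⇔ (y ≡ x)
fixed-g₄ x y = mk⇔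
  (λ fix → ℤ.*-cancelˡ-≡ (+ 2) y x
             (x-y≡y⇒x≡2y (+ 2 * y) x (cong proj₁ (trans (sym (action-g₄ x y)) fix))))
  (λ { refl → trans (action-g₄ x x) (cong (_, x) (2x-x≡x x)) })
  where
  2x-x≡x : ∀ x → + 2 * x - x ≡ x
  2x-x≡x = solve-∀

mainTheorem2 : ((g : Mat) → (IsGL2 g × IsIsometry g) ⇔ (g ∈ D₄))
    × Unique D₄
    × (g₅ ≡ g₁ · g₄) × (g₆ ≡ g₁ · g₃) × (g₇ ≡ g₁ · g₂)
    × ((x y : ℤ) → Fixed g₁ (x , y) ⇔ (y ≡ + 0))
    × ((x y : ℤ) → Fixed g₂ (x , y) ⇔ (x ≡ + 0))
    × ((x y : ℤ) → Fixed g₃ (x , y) ⇔ (x ≡ + 2 * y))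
    × ((x y : ℤ) → Fixed g₄ (x , y) ⇔ (y ≡ x))
mainTheorem2 =
    (λ g → mk⇔ (λ (gl , iso) → isometry⇒∈D₄ g gl iso)
               (λ g∈D₄ → All.lookup D₄-invertible g∈D₄ , All.lookup D₄-isometries g∈D₄))
  , from-yes (unique? D₄)
  , refl , refl , refl
  , fixed-g₁ , fixed-g₂ , fixed-g₃ , fixed-g₄
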